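{- Let $(\mathbb{A},D)$ be an ultra-designated $\mathsf{Cobounded}$-algebra. For all $u,v,w\in\mathbf{V}^{(\mathbb{A})}$: (i) $\llbracket u=u\rrbracket_{\mathrm{PA}}\in D$; (ii) for every $x\in\mathrm{dom}(u)$, if $u(x)\in D$ then $\llbracket x\in u\rrbracket_{\mathrm{PA}}\in D$; (iii) if $\llbracket u=v\rrbracket_{\mathrm{PA}}\wedge\llbracket v=w\rrbracket_{\mathrm{PA}}\in D$ then $\llbracket u=w\rrbracket_{\mathrm{PA}}\in D$; (iv) if $\llbracket u=v\rrbracket_{\mathrm{PA}}\wedge\llbracket v\in w\rrbracket_{\mathrm{PA}}\in D$ then $\llbracket u\in w\rrbracket_{\mathrm{PA}}\in D$; (v) if $\llbracket u=v\rrbracket_{\mathrm{PA}}\wedge\llbracket w\in v\rrbracket_{\mathrm{PA}}\in D$ then $\llbracket w\in u\rrbracket_{\mathrm{PA}}\in D$.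
   Context: A designated set is a lattice filter $D$ with $\mathbf{1}\in D$, $\mathbf{0}\notin D$. A $\mathsf{Cobounded}$-algebra is $\langle\mathbf{A},\wedge,\vee,\Rightarrow,\mathbf{1},\mathbf{0}\rangle$ with complete distributive lattice reduct, such that $\bigvee_i a_i=\mathbf{1}$ implies some $a_j=\mathbf{1}$, $\bigwedge_i a_i=\mathbf{0}$ implies some $a_j=\mathbf{0}$, and $a\Rightarrow b=\mathbf{0}$ if $a\ne\mathbf{0},b=\mathbf{0}$, else $\mathbf{1}$. A designated $\mathsf{Cobounded}$-algebra $(\mathbb{A},D)$ adds ${}^*$: $a^*=\mathbf{0}$ if $a=\mathbf{1}$, $a^*=a$ if $a\in D\setminus\{\mathbf{1}\}$, $a^*=\mathbf{1}$ if $a\notin D$; ultra-designated if $D$ is an ultrafilter. $\mathbf{V}^{(\mathbb{A})}$ = class of $\mathbf{A}$-valued functions defined by recursion ($\mathbf{V}^{(\mathbb{A})}_\alpha$ = functions with range in $\mathbf{A}$ and domain $\subseteq\mathbf{V}^{(\mathbb{A})}_\xi$, $\xi<\alpha$). $\llbracket u\in v\rrbracket_{\mathrm{PA}}=\bigvee_{x\in\mathrm{dom}(v)}(v(x)\wedge\llbracket x=u\rrbracket_{\mathrm{PA}})$, $\llbracket u=v\rrbracket_{\mathrm{PA}}=\bigwedge_{x\in\mathrm{dom}(u)}((u(x)\Rightarrow\llbracket x\in v\rrbracket_{\mathrm{PA}})\wedge(\llbracket x\in v\rrbracket_{\mathrm{PA}}^*\Rightarrow u(x)^*))\wedge\bigwedge_{y\in\mathrm{dom}(v)}((v(y)\Rightarrow\llbracket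 y\in u\rrbracket_{\mathrm{PA}})\wedge(\llbracket y\in u\rrbracket_{\mathrm{PA}}^*\Rightarrow v(y)^*))$. -}

module Defs where

open import Level using (Level; suc; _⊔_)
open import Data.Product using (Σ; _×_; _,_)
open import Relation.Nullary using (¬_)
open import Relation.Binary.PropositionalEquality using (_≡_; _≢_)

record CoboundedAlgebra (ℓ : Level) : Set (suc ℓ) where
  infixr 7 _∧_
  infixr 6 _∨_
  infixr 5 _⇒_
  infix 4 _≤_
  field
    Carrier : Set ℓ
    _≤_ : Carrier → Carrier → Set ℓ
    ≤-refl : ∀ {x} → x ≤ x
    ≤-trans : ∀ {x y z} → x ≤ y → y ≤ z → x ≤ z
    ≤-antisym : ∀ {x y} → x ≤ y → y ≤ x → x ≡ y
    _∧_ : Carrier → Carrier → Carrier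
    _∨_ : Carrier → Carrier → Carrier
    ∧-lowerˡ : ∀ x y → x ∧ y ≤ x
    ∧-lowerʳ : ∀ x y → x ∧ y ≤ y
    ∧-greatest : ∀ {x y z} → z ≤ x → z ≤ y → z ≤ x ∧ y
    ∨-upperˡ : ∀ x y → x ≤ x ∨ y
    ∨-upperʳ : ∀ x y → y ≤ x ∨ y
    ∨-least : ∀ {x y z} → x ≤ z → y ≤ z → x ∨ y ≤ z
    ∧-distribˡ-∨ : ∀ x y z → x ∧ (y ∨ z) ≡ (x ∧ y) ∨ (x ∧ z)
    ⋁ : {I : Set ℓ} → (I → Carrier) → Carrier
    ⋀ : {I : Set ℓ} → (I → Carrier) → Carrier
    ⋁-upper : ∀ {I : Set ℓ} (f : I → Carrier) i → f i ≤ ⋁ f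
    ⋁-least : ∀ {I : Set ℓ} (f : I → Carrier) z → (∀ i → f i ≤ z) → ⋁ f ≤ z
    ⋀-lower : ∀ {I : Set ℓ} (f : I → Carrier) i → ⋀ f ≤ f i
    ⋀-greatest : ∀ {I : Set ℓ} (f : I → Carrier) z → (∀ i → z ≤ f i) → z ≤ ⋀ f
    𝟏 : Carrier
    𝟎 : Carrier
    𝟏-top : ∀ x → x ≤ 𝟏
    𝟎-bottom : ∀ x → 𝟎 ≤ x
    ⋁-cobounded : ∀ {I : Set ℓ} (f : I → Carrier) → ⋁ f ≡ 𝟏 → Σ I (λ j → f j ≡ 𝟏)
    ⋀-cobounded : ∀ {I : Set ℓ} (f : I → Carrier) → ⋀ f ≡ 𝟎 → Σ I (λ j → f j ≡ 𝟎)
    _⇒_ : Carrier → Carrier → Carrier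
    ⇒-𝟎 : ∀ a b → a ≢ 𝟎 → b ≡ 𝟎 → a ⇒ b ≡ 𝟎
    ⇒-𝟏 : ∀ a b → ¬ (a ≢ 𝟎 × b ≡ 𝟎) → a ⇒ b ≡ 𝟏

module _ {ℓ : Level} (𝔸 : CoboundedAlgebra ℓ) where
  open CoboundedAlgebra 𝔸

  record IsProperFilter (F : Carrier → Set ℓ) : Set ℓ where
    field
      contains-𝟏 : F 𝟏
      upward : ∀ {a b} → a ≤ b → F a → F b
      ∧-closed : ∀ {a b} → F a → F b → F (a ∧ b)
      excludes-𝟎 : ¬ F 𝟎

  record IsUltrafilter (F : Carrier → Set ℓ) : Set (suc ℓ) where
    field
      isProperFilter : IsProperFilter F
      maximal : ∀ (G : Carrier → Set ℓ) → IsProperFilter G →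
                (∀ a → F a → G a) → ∀ a → G a → F a

record DesignatedCoboundedAlgebra (ℓ : Level) : Set (suc ℓ) where
  infix 9 _*
  field
    algebra : CoboundedAlgebra ℓ
  open CoboundedAlgebra algebra public
  field
    D : Carrier → Set ℓ
    D-designated : IsProperFilter algebra D
    _* : Carrier → Carrier
    *-𝟏 : ∀ a → a ≡ 𝟏 → a * ≡ 𝟎
    *-D : ∀ a → D a → a ≢ 𝟏 → a * ≡ a
    *-¬D : ∀ a → ¬ D a → a * ≡ 𝟏

UltraDesignated : ∀ {ℓ} → DesignatedCoboundedAlgebra ℓ → Set (suc ℓ)
UltraDesignated 𝔸D = IsUltrafilter algebra D
  where open DesignatedCoboundedAlgebra 𝔸D

module Names {ℓ : Level} (𝔸D : DesignatedCoboundedAlgebra ℓ) where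
  open DesignatedCoboundedAlgebra 𝔸D

  -- V^(A): well-founded A-valued names.  A name  node I f a  has domain
  -- the family (f i)_{i : I} and value a i at f i.
  data V : Set (suc ℓ) where
    node : (I : Set ℓ) → (I → V) → (I → Carrier) → V

  dom : V → Set ℓ
  dom (node I _ _) = I

  elt : (u : V) → dom u → V
  elt (node _ f _) = f

  val : (u : V) → dom u → Carrier
  val (node _ _ a) = a

  mutual
    ⟦_∈_⟧ : V → V → Carrier
    ⟦ u ∈ node J g b ⟧ = ⋁ (λ j → b j ∧ ⟦ g j ≐ u ⟧)

    ⟦_≐_⟧ : V → V → Carrier
    ⟦ node I f a ≐ node J g b ⟧ =
        ⋀ (λ i → (a i ⇒ ⟦ f i ∈ node J g b ⟧)
                 ∧ ((⟦ f i ∈ node J g b ⟧ *) ⇒ (a i *)))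
      ∧ ⋀ (λ j → (b j ⇒ ⟦ g j ∈ node I f a ⟧)
                 ∧ ((⟦ g j ∈ node I f a ⟧ *) ⇒ (b j *)))

{-# OPTIONS --safe #-}
module Submission where

-- Two observations make the Boolean-valued set theory collapse to a
-- two-level bisimulation.  First, ⇒ only takes the values 𝟎 and 𝟏, hence so
-- does ⟦ u ≐ v ⟧.  Second, by coboundedness both "≠ 𝟎" and "= 𝟏" are
-- completely prime filters, so ⟦ x ∈ v ⟧ is ≠ 𝟎 (resp. = 𝟏) exactly when some
-- y ∈ dom v has v(y) ≠ 𝟎 (resp. = 𝟏) and ⟦ y ≐ x ⟧ = 𝟏.  Unfolding ⟦ u ≐ v ⟧ = 𝟏
-- then says that, at both levels, every element of u lies in v and conversely,
-- so reflexivity, transitivity and the substitution laws follow by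
-- ∈-induction.  Finally, an ultrafilter D is exactly the set of nonzero
-- elements, since these form a proper filter containing every proper filter.

open import Defs
open import Level using (Level; Lift; lift; lower)
open import Data.Bool using (Bool; true; false)
open import Data.Empty using (⊥)
open import Data.Product using (_×_; Σ; _,_; proj₁; proj₂)
open import Function using (id; _∘_)
open import Relation.Binary.PropositionalEquality using (_≡_; _≢_; refl; sym; trans; subst)
open import Axiom.ExcludedMiddle using (ExcludedMiddle)
open import Axiom.DoubleNegationElimination using (DoubleNegationElimination; em⇒dne)

data Degree : Set where
  nonzero top : Degree

module CoboundedProperties {ℓ : Level} (𝔸 : CoboundedAlgebra ℓ) where
  open CoboundedAlgebra 𝔸

  ≡⇒≤ : ∀ {x y} → x ≡ y → x ≤ y
  ≡⇒≤ refl = ≤-refl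

  ≤𝟎⇒≡𝟎 : ∀ {x} → x ≤ 𝟎 → x ≡ 𝟎
  ≤𝟎⇒≡𝟎 {x} x≤𝟎 = ≤-antisym x≤𝟎 (𝟎-bottom x)

  𝟏≤⇒≡𝟏 : ∀ {x} → 𝟏 ≤ x → x ≡ 𝟏
  𝟏≤⇒≡𝟏 {x} 𝟏≤x = ≤-antisym (𝟏-top x) 𝟏≤x

  -- The empty join is 𝟎, so coboundedness forbids 𝟎 = 𝟏.
  𝟎≢𝟏 : 𝟎 ≢ 𝟏
  𝟎≢𝟏 𝟎≡𝟏 = lower (proj₁ (⋁-cobounded none (trans (≤𝟎⇒≡𝟎 (⋁-least none 𝟎 λ ())) 𝟎≡𝟏)))
    where
    none : Lift ℓ ⊥ → Carrier
    none ()

  pair : Carrier → Carrier → Lift ℓ Bool → Carrier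
  pair x y (lift true)  = x
  pair x y (lift false) = y

  ∧-≢𝟎 : ∀ {x y} → x ≢ 𝟎 → y ≢ 𝟎 → x ∧ y ≢ 𝟎
  ∧-≢𝟎 {x} {y} x≢𝟎 y≢𝟎 x∧y≡𝟎 with ⋀-cobounded (pair x y) ⋀≡𝟎
    where
    ⋀≡𝟎 : ⋀ (pair x y) ≡ 𝟎
    ⋀≡𝟎 = ≤𝟎⇒≡𝟎 (≤-trans (∧-greatest (⋀-lower _ (lift true)) (⋀-lower _ (lift false))) (≡⇒≤ x∧y≡𝟎))
  ... | lift true  , x≡𝟎 = x≢𝟎 x≡𝟎
  ... | lift false , y≡𝟎 = y≢𝟎 y≡𝟎

  Holds : Degree → Carrier → Set ℓ
  Holds nonzero x = x ≢ 𝟎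
  Holds top     x = x ≡ 𝟏

  holds-𝟏 : ∀ d → Holds d 𝟏
  holds-𝟏 nonzero = 𝟎≢𝟏 ∘ sym
  holds-𝟏 top     = refl

  holds-mono : ∀ d {x y} → x ≤ y → Holds d x → Holds d y
  holds-mono nonzero x≤y x≢𝟎 y≡𝟎 = x≢𝟎 (≤𝟎⇒≡𝟎 (≤-trans x≤y (≡⇒≤ y≡𝟎)))
  holds-mono top     x≤y x≡𝟏     = 𝟏≤⇒≡𝟏 (≤-trans (≡⇒≤ (sym x≡𝟏)) x≤y)

  holds-∧⁺ : ∀ d {x y} → Holds d x → Holds d y → Holds d (x ∧ y)
  holds-∧⁺ nonzero         = ∧-≢𝟎
  holds-∧⁺ top x≡𝟏 y≡𝟏 = 𝟏≤⇒≡𝟏 (∧-greatest (≡⇒≤ (sym x≡𝟏)) (≡⇒≤ (sym y≡𝟏)))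

  holds-∧⁻ : ∀ d {x y} → Holds d (x ∧ y) → Holds d x × Holds d y
  holds-∧⁻ d {x} {y} h = holds-mono d (∧-lowerˡ x y) h , holds-mono d (∧-lowerʳ x y) h

  nonzero-isProperFilter : IsProperFilter 𝔸 (Holds nonzero)
  nonzero-isProperFilter = record
    { contains-𝟏 = holds-𝟏 nonzero
    ; upward     = holds-mono nonzero
    ; ∧-closed   = holds-∧⁺ nonzero
    ; excludes-𝟎 = λ 𝟎≢𝟎 → 𝟎≢𝟎 refl
    }

  holds-⋁⁺ : ∀ d {I : Set ℓ} {f : I → Carrier} i → Holds d (f i) → Holds d (⋁ f)
  holds-⋁⁺ d {f = f} i = holds-mono d (⋁-upper f i)

  holds-⋁⁻ : DoubleNegationElimination ℓ → ∀ d {I : Set ℓ} {f : I → Carrier} →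
             Holds d (⋁ f) → Σ I (Holds d ∘ f)
  holds-⋁⁻ _   top     {f = f} = ⋁-cobounded f
  holds-⋁⁻ dne nonzero {f = f} ⋁f≢𝟎 = dne λ noWitness →
    ⋁f≢𝟎 (≤𝟎⇒≡𝟎 (⋁-least f 𝟎 λ i → ≡⇒≤ (dne λ fi≢𝟎 → noWitness (i , fi≢𝟎))))

  ⋀-≡𝟏⁺ : ∀ {I : Set ℓ} {f : I → Carrier} → (∀ i → f i ≡ 𝟏) → ⋀ f ≡ 𝟏
  ⋀-≡𝟏⁺ {f = f} fi≡𝟏 = 𝟏≤⇒≡𝟏 (⋀-greatest f 𝟏 (≡⇒≤ ∘ sym ∘ fi≡𝟏))

  ⋀-≡𝟏⁻ : ∀ {I : Set ℓ} {f : I → Carrier} → ⋀ f ≡ 𝟏 → ∀ i → f i ≡ 𝟏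
  ⋀-≡𝟏⁻ {f = f} ⋀f≡𝟏 i = holds-mono top (⋀-lower f i) ⋀f≡𝟏

  ⇒-≡𝟏⁺ : ∀ {x y} → (x ≢ 𝟎 → y ≢ 𝟎) → x ⇒ y ≡ 𝟏
  ⇒-≡𝟏⁺ {x} {y} h = ⇒-𝟏 x y λ (x≢𝟎 , y≡𝟎) → h x≢𝟎 y≡𝟎

  ⇒-≡𝟏⁻ : ∀ {x y} → x ⇒ y ≡ 𝟏 → x ≢ 𝟎 → y ≢ 𝟎
  ⇒-≡𝟏⁻ {x} {y} x⇒y≡𝟏 x≢𝟎 y≡𝟎 = 𝟎≢𝟏 (trans (sym (⇒-𝟎 x y x≢𝟎 y≡𝟎)) x⇒y≡𝟏)

  -- Classically: x ∈ {𝟎, 𝟏}.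
  TwoValued : Carrier → Set ℓ
  TwoValued x = x ≢ 𝟎 → x ≡ 𝟏

  twoValued-holds : ∀ d {x} → TwoValued x → Holds d x → x ≡ 𝟏
  twoValued-holds nonzero = id
  twoValued-holds top _   = id

  ⇒-twoValued : ∀ x y → TwoValued (x ⇒ y)
  ⇒-twoValued x y x⇒y≢𝟎 = ⇒-𝟏 x y λ (x≢𝟎 , y≡𝟎) → x⇒y≢𝟎 (⇒-𝟎 x y x≢𝟎 y≡𝟎)

  ∧-twoValued : ∀ {x y} → TwoValued x → TwoValued y → TwoValued (x ∧ y)
  ∧-twoValued tx ty x∧y≢𝟎 =
    let (x≢𝟎 , y≢𝟎) = holds-∧⁻ nonzero x∧y≢𝟎 in holds-∧⁺ top (tx x≢𝟎) (ty y≢𝟎)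

  ⋀-twoValued : ∀ {I : Set ℓ} {f : I → Carrier} → (∀ i → TwoValued (f i)) → TwoValued (⋀ f)
  ⋀-twoValued {f = f} t ⋀f≢𝟎 = ⋀-≡𝟏⁺ λ i → t i (holds-mono nonzero (⋀-lower f i) ⋀f≢𝟎)

module DesignatedProperties {ℓ : Level} (dne : DoubleNegationElimination ℓ)
                            (𝔸D : DesignatedCoboundedAlgebra ℓ) where
  open DesignatedCoboundedAlgebra 𝔸D
  open CoboundedProperties algebra
  open IsProperFilter D-designated
  open Names 𝔸D

  D⇒≢𝟎 : ∀ {x} → D x → x ≢ 𝟎
  D⇒≢𝟎 Dx x≡𝟎 = excludes-𝟎 (subst D x≡𝟎 Dx)

  D-∧⁻ : ∀ {x y} → D (x ∧ y) → D x × D y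
  D-∧⁻ {x} {y} Dx∧y = upward (∧-lowerˡ x y) Dx∧y , upward (∧-lowerʳ x y) Dx∧y

  ultra-≢𝟎⇒D : UltraDesignated 𝔸D → ∀ {x} → x ≢ 𝟎 → D x
  ultra-≢𝟎⇒D ud {x} = IsUltrafilter.maximal ud (Holds nonzero) nonzero-isProperFilter (λ _ → D⇒≢𝟎) x

  *≡𝟎⇒≡𝟏 : ∀ {x} → x * ≡ 𝟎 → x ≡ 𝟏
  *≡𝟎⇒≡𝟏 {x} x*≡𝟎 = dne λ x≢𝟏 →
    𝟎≢𝟏 (trans (sym x*≡𝟎) (*-¬D x λ Dx → D⇒≢𝟎 (subst D (sym (*-D x Dx x≢𝟏)) Dx) x*≡𝟎))

  infixr 5 _⊸_
  infix 4 _⊑_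

  _⊸_ : Carrier → Carrier → Carrier
  a ⊸ m = (a ⇒ m) ∧ (m * ⇒ a *)

  _⊑_ : Carrier → Carrier → Set ℓ
  a ⊑ m = ∀ d → Holds d a → Holds d m

  ⊸-twoValued : ∀ a m → TwoValued (a ⊸ m)
  ⊸-twoValued a m = ∧-twoValued (⇒-twoValued a m) (⇒-twoValued (m *) (a *))

  ⊸-≡𝟏⁺ : ∀ {a m} → a ⊑ m → a ⊸ m ≡ 𝟏
  ⊸-≡𝟏⁺ {a} {m} a⊑m = holds-∧⁺ top (⇒-≡𝟏⁺ (a⊑m nonzero))
    (⇒-≡𝟏⁺ λ m*≢𝟎 a*≡𝟎 → m*≢𝟎 (*-𝟏 m (a⊑m top (*≡𝟎⇒≡𝟏 a*≡𝟎))))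

  ⊸-≡𝟏⁻ : ∀ {a m} → a ⊸ m ≡ 𝟏 → a ⊑ m
  ⊸-≡𝟏⁻ a⊸m≡𝟏 nonzero = ⇒-≡𝟏⁻ (proj₁ (holds-∧⁻ top a⊸m≡𝟏))
  ⊸-≡𝟏⁻ {a} a⊸m≡𝟏 top a≡𝟏 =
    *≡𝟎⇒≡𝟏 (dne λ m*≢𝟎 → ⇒-≡𝟏⁻ (proj₂ (holds-∧⁻ top a⊸m≡𝟏)) m*≢𝟎 (*-𝟏 a a≡𝟏))

  ≐-twoValued : ∀ u v → TwoValued ⟦ u ≐ v ⟧
  ≐-twoValued (node _ _ _) (node _ _ _) =
    ∧-twoValued (⋀-twoValued λ _ → ⊸-twoValued _ _) (⋀-twoValued λ _ → ⊸-twoValued _ _)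

  infix 4 _≈_ _⊆_

  _≈_ : V → V → Set ℓ
  u ≈ v = ⟦ u ≐ v ⟧ ≡ 𝟏

  _⊆_ : V → V → Set ℓ
  u ⊆ v = ∀ i → val u i ⊑ ⟦ elt u i ∈ v ⟧

  ≈⇒⊆ : ∀ u v → u ≈ v → u ⊆ v × v ⊆ u
  ≈⇒⊆ (node _ _ _) (node _ _ _) u≈v =
    let (⋀ˡ≡𝟏 , ⋀ʳ≡𝟏) = holds-∧⁻ top u≈v in ⊸-≡𝟏⁻ ∘ ⋀-≡𝟏⁻ ⋀ˡ≡𝟏 , ⊸-≡𝟏⁻ ∘ ⋀-≡𝟏⁻ ⋀ʳ≡𝟏

  ⊆⇒≈ : ∀ u v → u ⊆ v → v ⊆ u → u ≈ v
  ⊆⇒≈ (node _ _ _) (node _ _ _) u⊆v v⊆u =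
    holds-∧⁺ top (⋀-≡𝟏⁺ (⊸-≡𝟏⁺ ∘ u⊆v)) (⋀-≡𝟏⁺ (⊸-≡𝟏⁺ ∘ v⊆u))

  ∈-holds⁺ : ∀ d x v j → Holds d (val v j) → elt v j ≈ x → Holds d ⟦ x ∈ v ⟧
  ∈-holds⁺ d x (node _ _ _) j hj gj≈x =
    holds-⋁⁺ d j (holds-∧⁺ d hj (subst (Holds d) (sym gj≈x) (holds-𝟏 d)))

  ∈-holds⁻ : ∀ d x v → Holds d ⟦ x ∈ v ⟧ → Σ (dom v) λ j → Holds d (val v j) × elt v j ≈ x
  ∈-holds⁻ d x (node _ g _) h =
    let (j , hj∧) = holds-⋁⁻ dne d h
        (hj , h≐) = holds-∧⁻ d hj∧
    in j , hj , twoValued-holds d (≐-twoValued (g j) x) h≐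

  ≈-refl : ∀ u → u ≈ u
  ≈-refl u@(node _ f _) = ⊆⇒≈ u u u⊆u u⊆u
    where
    u⊆u : u ⊆ u
    u⊆u i d hi = ∈-holds⁺ d (f i) u i hi (≈-refl (f i))

  ≈-sym : ∀ u v → u ≈ v → v ≈ u
  ≈-sym u v u≈v = let (u⊆v , v⊆u) = ≈⇒⊆ u v u≈v in ⊆⇒≈ v u v⊆u u⊆v

  ⊆-trans : ∀ u v w → (∀ i j k → elt w k ≈ elt v j → elt v j ≈ elt u i → elt w k ≈ elt u i) →
            u ⊆ v → v ⊆ w → u ⊆ w
  ⊆-trans u v w ≈-trans-elt u⊆v v⊆w i d hi =
    let (j , hj , vj≈ui) = ∈-holds⁻ d (elt u i) v (u⊆v i d hi)
        (k , hk , wk≈vj) = ∈-holds⁻ d (elt v j) w (v⊆w j d hj)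
    in ∈-holds⁺ d (elt u i) w k hk (≈-trans-elt i j k wk≈vj vj≈ui)

  ≈-trans : ∀ u v w → u ≈ v → v ≈ w → u ≈ w
  ≈-trans u@(node I f a) v@(node J g b) w@(node K h c) u≈v v≈w =
    let (u⊆v , v⊆u) = ≈⇒⊆ u v u≈v
        (v⊆w , w⊆v) = ≈⇒⊆ v w v≈w
    in ⊆⇒≈ u w (⊆-trans u v w (λ i j k → ≈-trans (h k) (g j) (f i)) u⊆v v⊆w)
               (⊆-trans w v u (λ k j i → ≈-trans (f i) (g j) (h k)) w⊆v v⊆u)

  ∈-respˡ : ∀ d u v w → u ≈ v → Holds d ⟦ v ∈ w ⟧ → Holds d ⟦ u ∈ w ⟧
  ∈-respˡ d u v w u≈v h =
    let (k , hk , wk≈v) = ∈-holds⁻ d v w h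
    in ∈-holds⁺ d u w k hk (≈-trans (elt w k) v u wk≈v (≈-sym u v u≈v))

  ∈-respʳ : ∀ d u v w → u ≈ v → Holds d ⟦ w ∈ v ⟧ → Holds d ⟦ w ∈ u ⟧
  ∈-respʳ d u v w u≈v h =
    let (j , hj , vj≈w) = ∈-holds⁻ d w v h
    in ∈-respˡ d w (elt v j) u (≈-sym (elt v j) w vj≈w) (proj₂ (≈⇒⊆ u v u≈v) j d hj)

  D⇒≈ : ∀ u v → D ⟦ u ≐ v ⟧ → u ≈ v
  D⇒≈ u v = ≐-twoValued u v ∘ D⇒≢𝟎

  ≈⇒D : ∀ u v → u ≈ v → D ⟦ u ≐ v ⟧
  ≈⇒D u v u≈v = subst D (sym u≈v) contains-𝟏

mainTheorem18 : ∀ {ℓ : Level} → ExcludedMiddle ℓ → (𝔸D : DesignatedCoboundedAlgebra ℓ) →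
    UltraDesignated 𝔸D →
    let open DesignatedCoboundedAlgebra 𝔸D in
    let open Names 𝔸D in
    ∀ (u v w : V) →
      D ⟦ u ≐ u ⟧
    × (∀ (x : dom u) → D (val u x) → D ⟦ elt u x ∈ u ⟧)
    × (D (⟦ u ≐ v ⟧ ∧ ⟦ v ≐ w ⟧) → D ⟦ u ≐ w ⟧)
    × (D (⟦ u ≐ v ⟧ ∧ ⟦ v ∈ w ⟧) → D ⟦ u ∈ w ⟧)
    × (D (⟦ u ≐ v ⟧ ∧ ⟦ w ∈ v ⟧) → D ⟦ w ∈ u ⟧)
mainTheorem18 em 𝔸D ud u v w =
    ≈⇒D u u (≈-refl u)
  , (λ x Dux → ≢𝟎⇒D (∈-holds⁺ nonzero (elt u x) u x (D⇒≢𝟎 Dux) (≈-refl (elt u x))))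
  , (λ D[u≐v∧v≐w] → let (Du≐v , Dv≐w) = D-∧⁻ D[u≐v∧v≐w] in
       ≈⇒D u w (≈-trans u v w (D⇒≈ u v Du≐v) (D⇒≈ v w Dv≐w)))
  , (λ D[u≐v∧v∈w] → let (Du≐v , Dv∈w) = D-∧⁻ D[u≐v∧v∈w] in
       ≢𝟎⇒D (∈-respˡ nonzero u v w (D⇒≈ u v Du≐v) (D⇒≢𝟎 Dv∈w)))
  , (λ D[u≐v∧w∈v] → let (Du≐v , Dw∈v) = D-∧⁻ D[u≐v∧w∈v] in
       ≢𝟎⇒D (∈-respʳ nonzero u v w (D⇒≈ u v Du≐v) (D⇒≢𝟎 Dw∈v)))
  where
  open DesignatedCoboundedAlgebra 𝔸D
  open Names 𝔸D
  open DesignatedProperties (em⇒dne em) 𝔸D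

  ≢𝟎⇒D : ∀ {x} → x ≢ 𝟎 → D x
  ≢𝟎⇒D = ultra-≢𝟎⇒D ud
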